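{- Suppose the Fermat primes $F_1,\dots,F_k$ exist and let $F=\prod_{i=1}^k F_i$. If $F_{k+1}$ also exists, then $2^aF\in N_2$ for every integer $a$ with $1\le a\le\log_2(F_{k+1}-1)$. If $F_{k+1}$ does not exist, then $2^aF\in N_2$ for every $a\in\mathbb{N}$.
   Context: A Fermat prime is a prime of the form $2^{2^l}+1$ with $l\ge0$; $F_j$ denotes the $j$-th Fermat prime in increasing order. $\phi$ is Euler's totient function, $V=\phi(\mathbb{N})$, $N_2(m)=\max\{x\in\mathbb{N}\colon\phi(x)=m\}$ for $m\in V$, and $N_2=\{N_2(m)\colon m\in V\}$. -}

module Defs where

open import Data.Nat using (ℕ; zero; suc; _+_; _*_; _^_; _≤_; _<_)
open import Data.Nat.GCD using (gcd)
open import Data.Nat.Primality using (Prime)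
open import Data.Fin using (Fin; zero; suc)
open import Data.List using (List; []; _∷_; filter; length; upTo; map)
open import Data.Nat.Properties using (_≟_)
open import Data.Product using (_×_; ∃)
open import Relation.Binary.PropositionalEquality using (_≡_)

-- Euler's totient: φ n = #{ i ∈ [1..n] : gcd i n = 1 }   (so φ 0 = 0)
φ : ℕ → ℕ
φ n = length (filter (λ i → gcd i n ≟ 1) (map suc (upTo n)))

FermatPrime : ℕ → Set
FermatPrime p = Prime p × ∃ λ l → p ≡ 2 ^ (2 ^ l) + 1

-- FermatNo j p : p is the j-th Fermat prime F_j in increasing order (1-based)
data FermatNo : ℕ → ℕ → Set where
  first : ∀ {p} → FermatPrime p → (∀ r → FermatPrime r → p ≤ r) → FermatNo 1 p
  next  : ∀ {j p q} → FermatNo j p → FermatPrime q → p < q →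
          (∀ r → FermatPrime r → p < r → q ≤ r) → FermatNo (suc j) q

-- x = N₂(m): x is the maximum of φ⁻¹(m)
IsN₂ : ℕ → ℕ → Set
IsN₂ m x = φ x ≡ m × (∀ y → φ y ≡ m → y ≤ x)

-- x ∈ N₂ = { N₂(m) : m ∈ V }
InN₂ : ℕ → Set
InN₂ x = ∃ λ m → (∃ λ y → φ y ≡ m) × IsN₂ m x

prodFin : ∀ k → (Fin k → ℕ) → ℕ
prodFin zero    f = 1
prodFin (suc k) f = f zero * prodFin k (λ i → f (suc i))

{-# OPTIONS --safe #-}
-- Write F = F₁ ⋯ F_k and x = 2^a F, so that φ x = 2^(a−1) φ F is a power of two. Any y with
-- φ y = φ x is 2^b o with o odd and φ o dividing a power of two, so o is a product of distinct
-- Fermat primes p, each with p − 1 ≤ φ x. A Fermat prime beyond q = F_{k+1} has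
-- p − 1 ≥ (q − 1)² > φ x (because F ∣ q − 2 and 2^a ≤ q − 1), so o is a divisor g of F,
-- possibly times q. Comparing 2^b φ o = 2^(a−1) φ F then gives y ≤ x: directly when o ∣ F, and
-- when o = q g because the cofactor c = F / g is nontrivial with all prime factors below q, so
-- that φ c / c ≤ (q − 1) / q. Without F_{k+1} the factor q never occurs.
module Submission where

open import Defs
open import Data.Nat
open import Data.Nat.Properties
open import Data.Nat.Divisibility
open import Data.Nat.GCD using (gcd)
open import Data.Nat.Coprimality using (Coprime; coprime?; coprime⇒gcd≡1; gcd≡1⇒coprime; coprime-divisor)
import Data.Nat.Coprimality as Coprimality
open import Data.Nat.Primality
open import Data.List using (filter; length; upTo; map; _++_; [_]; _∷_)
import Data.List.Properties as Listₚ
open import Data.Fin using (Fin; zero; suc; toℕ; fromℕ; fromℕ<)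
import Data.Fin.Properties as Finₚ
open import Function.Definitions using (Injective)
open import Data.Maybe using (Maybe; just; nothing)
open import Data.Maybe.Properties using (just-injective)
open import Data.Nat.Primality.Factorisation using (factorise)
open import Data.Nat.ListAction using (product)
open import Data.List.Relation.Unary.All using (_∷_)
open import Data.Product using (∃; _×_; _,_; proj₁; proj₂)
open import Relation.Binary.Definitions using (tri<; tri≈; tri>)
open import Data.Sum using (_⊎_; inj₁; inj₂)
open import Data.Empty using (⊥-elim)
open import Function using (_∘_)
open import Relation.Nullary using (¬_; Dec; yes; no)
open import Relation.Nullary.Decidable using (_×-dec_; map′; from-yes)
open import Relation.Unary using (Pred; Decidable)
open import Relation.Binary.PropositionalEquality hiding ([_])
open import Data.Nat.Induction using (<-rec)
open import Data.Nat.Tactic.RingSolver using (solve-∀)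
open import Level using (0ℓ)
open import Algebra.Properties.CommutativeSemigroup +-commutativeSemigroup using (interchange)
open import Algebra.Properties.CommutativeSemigroup *-commutativeSemigroup
  using (x∙yz≈y∙xz; x∙yz≈y∙zx; x∙yz≈x∙zy; xy∙z≈y∙zx; xy∙z≈x∙zy)

indicator : {A : Set} → Dec A → ℕ
indicator (yes _) = 1
indicator (no _)  = 0

indicator≤1 : {A : Set} (a? : Dec A) → indicator a? ≤ 1
indicator≤1 (yes _) = ≤-refl
indicator≤1 (no _)  = z≤n

indicator-⇔ : {A B : Set} → (A → B) → (B → A) →
              (a? : Dec A) (b? : Dec B) → indicator a? ≡ indicator b?
indicator-⇔ f g (yes _) (yes _) = refl
indicator-⇔ f g (no _)  (no _)  = refl
indicator-⇔ f g (yes a) (no ¬b) = ⊥-elim (¬b (f a))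
indicator-⇔ f g (no ¬a) (yes b) = ⊥-elim (¬a (g b))

indicator-⊎ : {A B C : Set} → (A → B ⊎ C) → (B → A) → (C → A) → (B → ¬ C) →
              (a? : Dec A) (b? : Dec B) (c? : Dec C) →
              indicator a? ≡ indicator b? + indicator c?
indicator-⊎ f g h disj (yes a) (yes b) (yes c) = ⊥-elim (disj b c)
indicator-⊎ f g h disj (yes a) (yes b) (no _)  = refl
indicator-⊎ f g h disj (yes a) (no _)  (yes c) = refl
indicator-⊎ f g h disj (yes a) (no ¬b) (no ¬c) with f a
... | inj₁ b = ⊥-elim (¬b b)
... | inj₂ c = ⊥-elim (¬c c)
indicator-⊎ f g h disj (no ¬a) (yes b) _       = ⊥-elim (¬a (g b))
indicator-⊎ f g h disj (no ¬a) (no _)  (yes c) = ⊥-elim (¬a (h c))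
indicator-⊎ f g h disj (no _)  (no _)  (no _)  = refl

sumFrom : (ℕ → ℕ) → ℕ → ℕ → ℕ
sumFrom f s zero    = 0
sumFrom f s (suc n) = sumFrom f s n + f (s + suc n)

sumFrom-+ : ∀ f s m n → sumFrom f s (m + n) ≡ sumFrom f s m + sumFrom f (s + m) n
sumFrom-+ f s m zero    = trans (cong (sumFrom f s) (+-identityʳ m)) (sym (+-identityʳ _))
sumFrom-+ f s m (suc n) = begin
  sumFrom f s (m + suc n)                                 ≡⟨ cong (sumFrom f s) (+-suc m n) ⟩
  sumFrom f s (m + n) + f (s + suc (m + n))               ≡⟨ cong₂ _+_ (sumFrom-+ f s m n) (cong f index) ⟩
  sumFrom f s m + sumFrom f (s + m) n + f (s + m + suc n) ≡⟨ +-assoc (sumFrom f s m) _ _ ⟩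
  sumFrom f s m + sumFrom f (s + m) (suc n)               ∎
  where
  open ≡-Reasoning
  index : s + suc (m + n) ≡ s + m + suc n
  index = trans (cong (s +_) (sym (+-suc m n))) (sym (+-assoc s m (suc n)))

sumFrom-cong : ∀ {f g} → (∀ i → f i ≡ g i) → ∀ s n → sumFrom f s n ≡ sumFrom g s n
sumFrom-cong f≗g s zero    = refl
sumFrom-cong f≗g s (suc n) = cong₂ _+_ (sumFrom-cong f≗g s n) (f≗g (s + suc n))

sumFrom-+-pointwise : ∀ {f g h} → (∀ i → f i ≡ g i + h i) → ∀ s n →
                      sumFrom f s n ≡ sumFrom g s n + sumFrom h s n
sumFrom-+-pointwise e s zero    = refl
sumFrom-+-pointwise {f} {g} {h} e s (suc n) =
  trans (cong₂ _+_ (sumFrom-+-pointwise {f} {g} {h} e s n) (e (s + suc n)))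
        (interchange (sumFrom g s n) (sumFrom h s n) (g (s + suc n)) (h (s + suc n)))

sumFrom-zero : ∀ {f} s n → (∀ j → j < n → f (s + suc j) ≡ 0) → sumFrom f s n ≡ 0
sumFrom-zero s zero    _ = refl
sumFrom-zero {f} s (suc n) h = cong₂ _+_ (sumFrom-zero {f} s n (λ j j<n → h j (m<n⇒m<1+n j<n))) (h n ≤-refl)

sumFrom-≤ : ∀ {f} → (∀ i → f i ≤ 1) → ∀ s n → sumFrom f s n ≤ n
sumFrom-≤ f≤1 s zero    = z≤n
sumFrom-≤ f≤1 s (suc n) = subst (_≤ suc n) (+-comm _ (sumFrom _ s n))
                                 (+-mono-≤ (f≤1 (s + suc n)) (sumFrom-≤ f≤1 s n))

sumFrom-shift : ∀ f s m n → sumFrom f (s + m) n ≡ sumFrom (λ i → f (i + m)) s n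
sumFrom-shift f s m zero    = refl
sumFrom-shift f s m (suc n) = cong₂ _+_ (sumFrom-shift f s m n) (cong f (+-comm-middle s m (suc n)))
  where
  +-comm-middle : ∀ a b c → a + b + c ≡ a + c + b
  +-comm-middle = solve-∀

sumFrom-periodic : ∀ {f} m → (∀ i → f (i + m) ≡ f i) → ∀ t → sumFrom f 0 (t * m) ≡ t * sumFrom f 0 m
sumFrom-periodic m periodic zero    = refl
sumFrom-periodic {f} m periodic (suc t) = begin
  sumFrom f 0 (m + t * m)                ≡⟨ sumFrom-+ f 0 m (t * m) ⟩
  sumFrom f 0 m + sumFrom f m (t * m)    ≡⟨ cong (sumFrom f 0 m +_) (sumFrom-shift f 0 m (t * m)) ⟩
  sumFrom f 0 m + sumFrom (λ i → f (i + m)) 0 (t * m)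
    ≡⟨ cong (sumFrom f 0 m +_) (sumFrom-cong {λ i → f (i + m)} {f} periodic 0 (t * m)) ⟩
  sumFrom f 0 m + sumFrom f 0 (t * m)    ≡⟨ cong (sumFrom f 0 m +_) (sumFrom-periodic {f} m periodic t) ⟩
  sumFrom f 0 m + t * sumFrom f 0 m      ∎
  where open ≡-Reasoning

sumFrom-multiples : ∀ {g} p .{{_ : NonZero p}} → (∀ i → ¬ p ∣ i → g i ≡ 0) →
                    ∀ t → sumFrom g 0 (t * p) ≡ sumFrom (λ j → g (j * p)) 0 t
sumFrom-multiples p         vanish zero    = refl
sumFrom-multiples {g} p@(suc p′) vanish (suc t) = begin
  sumFrom g 0 (p + t * p)                          ≡⟨ cong (sumFrom g 0) (+-comm p (t * p)) ⟩
  sumFrom g 0 (t * p + p)                          ≡⟨ sumFrom-+ g 0 (t * p) p ⟩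
  sumFrom g 0 (t * p) + (sumFrom g (t * p) p′ + g (t * p + p))
    ≡⟨ cong₂ (λ x y → x + (y + g (t * p + p))) (sumFrom-multiples {g} p vanish t) inner ⟩
  sumFrom (λ j → g (j * p)) 0 t + g (t * p + p)
    ≡⟨ cong (λ x → sumFrom (λ j → g (j * p)) 0 t + g x) (+-comm (t * p) p) ⟩
  sumFrom (λ j → g (j * p)) 0 t + g (p + t * p)    ∎
  where
  open ≡-Reasoning
  inner : sumFrom g (t * p) p′ ≡ 0
  inner = sumFrom-zero (t * p) p′ λ j j<p′ → vanish _ λ p∣ →
    <⇒≱ (s≤s j<p′) (∣⇒≤ (∣m+n∣m⇒∣n p∣ (n∣m*n t)))

coprime-∣ˡ : ∀ {d i n} → d ∣ i → Coprime i n → Coprime d n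
coprime-∣ˡ d∣i coprime (e∣d , e∣n) = coprime (∣-trans e∣d d∣i , e∣n)

coprime-∣ʳ : ∀ {d i n} → d ∣ n → Coprime i n → Coprime i d
coprime-∣ʳ d∣n coprime (e∣i , e∣d) = coprime (e∣i , ∣-trans e∣d d∣n)

coprime-* : ∀ {i a b} → Coprime i a → Coprime i b → Coprime i (a * b)
coprime-* ca cb (d∣i , d∣ab) = cb (d∣i , coprime-divisor (coprime-∣ˡ d∣i ca) d∣ab)

coprime-+ʳ : ∀ {i n} → Coprime (i + n) n → Coprime i n
coprime-+ʳ coprime (d∣i , d∣n) = coprime (∣m∣n⇒∣m+n d∣i d∣n , d∣n)

prime-∤⇒coprime : ∀ {p m} → Prime p → ¬ p ∣ m → Coprime m p
prime-∤⇒coprime p-prime p∤m {d} (d∣m , d∣p) with prime⇒irreducible p-prime d∣p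
... | inj₁ d≡1    = d≡1
... | inj₂ refl   = ⊥-elim (p∤m d∣m)

prime≢1 : ∀ {p} → Prime p → p ≢ 1
prime≢1 (prime {{()}} _) refl

prime>1 : ∀ {p} → Prime p → 1 < p
prime>1 {p} p-prime = nonTrivial⇒n>1 p {{prime⇒nonTrivial p-prime}}

prime-pred+1 : ∀ {p} → Prime p → p ∸ 1 + 1 ≡ p
prime-pred+1 p-prime = m∸n+n≡m (<⇒≤ (prime>1 p-prime))

prime-∣⇒¬coprime : ∀ {p i n} → Prime p → p ∣ i → p ∣ n → ¬ Coprime i n
prime-∣⇒¬coprime p-prime p∣i p∣n coprime = prime≢1 p-prime (coprime (p∣i , p∣n))

-- Euler's totient

coprimeTo : ℕ → ℕ → ℕ
coprimeTo n i = indicator (coprime? i n)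

length-filter-[_] : ∀ {P : Pred ℕ 0ℓ} (P? : Decidable P) x → length (filter P? [ x ]) ≡ indicator (P? x)
length-filter-[ P? ] x with P? x
... | yes _ = refl
... | no _  = refl

length-filter-upTo : ∀ {P : Pred ℕ 0ℓ} (P? : Decidable P) n →
                     length (filter P? (map suc (upTo n))) ≡ sumFrom (indicator ∘ P?) 0 n
length-filter-upTo P? zero    = refl
length-filter-upTo P? (suc n) = begin
  length (filter P? (map suc (upTo (suc n))))
    ≡⟨ cong (length ∘ filter P? ∘ map suc) (sym (Listₚ.upTo-∷ʳ n)) ⟩
  length (filter P? (map suc (upTo n ++ [ n ])))
    ≡⟨ cong (length ∘ filter P?) (Listₚ.map-++ suc (upTo n) [ n ]) ⟩
  length (filter P? (map suc (upTo n) ++ [ suc n ]))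
    ≡⟨ cong length (Listₚ.filter-++ P? (map suc (upTo n)) [ suc n ]) ⟩
  length (filter P? (map suc (upTo n)) ++ filter P? [ suc n ])
    ≡⟨ Listₚ.length-++ (filter P? (map suc (upTo n))) ⟩
  length (filter P? (map suc (upTo n))) + length (filter P? [ suc n ])
    ≡⟨ cong₂ _+_ (length-filter-upTo P? n) (length-filter-[ P? ] (suc n)) ⟩
  sumFrom (indicator ∘ P?) 0 (suc n) ∎
  where open ≡-Reasoning

φ≡sumFrom : ∀ n → φ n ≡ sumFrom (coprimeTo n) 0 n
φ≡sumFrom n = trans (length-filter-upTo (λ i → gcd i n ≟ 1) n) (sumFrom-cong gcd≡1⇔coprime 0 n)
  where
  gcd≡1⇔coprime : ∀ i → indicator (gcd i n ≟ 1) ≡ coprimeTo n i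
  gcd≡1⇔coprime i = indicator-⇔ gcd≡1⇒coprime coprime⇒gcd≡1 (gcd i n ≟ 1) (coprime? i n)

sumFrom-coprimeTo : ∀ m t → sumFrom (coprimeTo m) 0 (t * m) ≡ t * φ m
sumFrom-coprimeTo m t =
  trans (sumFrom-periodic {coprimeTo m} m periodic t) (cong (t *_) (sym (φ≡sumFrom m)))
  where
  periodic : ∀ i → coprimeTo m (i + m) ≡ coprimeTo m i
  periodic i = indicator-⇔ coprime-+ʳ
    (λ c → subst (λ x → Coprime x m) (+-comm m i) (Coprimality.coprime-+ c))
    (coprime? (i + m) m) (coprime? i m)

φ-prime*-∣ : ∀ {p m} → Prime p → p ∣ m → φ (p * m) ≡ p * φ m
φ-prime*-∣ {p} {m} p-prime p∣m = begin
  φ (p * m)                              ≡⟨ φ≡sumFrom (p * m) ⟩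
  sumFrom (coprimeTo (p * m)) 0 (p * m)  ≡⟨ sumFrom-cong same 0 (p * m) ⟩
  sumFrom (coprimeTo m) 0 (p * m)        ≡⟨ sumFrom-coprimeTo m p ⟩
  p * φ m                                ∎
  where
  open ≡-Reasoning
  same : ∀ i → coprimeTo (p * m) i ≡ coprimeTo m i
  same i = indicator-⇔ (coprime-∣ʳ (n∣m*n p)) (λ c → coprime-* (coprime-∣ʳ p∣m c) c)
    (coprime? i (p * m)) (coprime? i m)

coprimeMultipleOf : ℕ → ℕ → ℕ → ℕ
coprimeMultipleOf p m i = indicator (p ∣? i ×-dec coprime? i m)

coprimeTo-split : ∀ {p m} → Prime p → ∀ i → coprimeTo m i ≡ coprimeTo (p * m) i + coprimeMultipleOf p m i
coprimeTo-split {p} {m} p-prime i = indicator-⊎ by-p∣i (coprime-∣ʳ (n∣m*n p)) proj₂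
  (λ c (p∣i , _) → prime-∣⇒¬coprime p-prime p∣i (m∣m*n m) c)
  (coprime? i m) (coprime? i (p * m)) (p ∣? i ×-dec coprime? i m)
  where
  by-p∣i : Coprime i m → Coprime i (p * m) ⊎ (p ∣ i × Coprime i m)
  by-p∣i c with p ∣? i
  ... | yes p∣i = inj₂ (p∣i , c)
  ... | no p∤i  = inj₁ (coprime-* (prime-∤⇒coprime p-prime p∤i) c)

sumFrom-coprimeMultipleOf : ∀ {p m} → Prime p → ¬ p ∣ m → sumFrom (coprimeMultipleOf p m) 0 (p * m) ≡ φ m
sumFrom-coprimeMultipleOf {p} {m} p-prime p∤m = begin
  sumFrom counted 0 (p * m)             ≡⟨ cong (sumFrom counted 0) (*-comm p m) ⟩
  sumFrom counted 0 (m * p)             ≡⟨ sumFrom-multiples {counted} p {{prime⇒nonZero p-prime}} vanish m ⟩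
  sumFrom (λ j → counted (j * p)) 0 m   ≡⟨ sumFrom-cong onMultiples 0 m ⟩
  sumFrom (coprimeTo m) 0 m             ≡⟨ sym (φ≡sumFrom m) ⟩
  φ m                                   ∎
  where
  open ≡-Reasoning
  counted = coprimeMultipleOf p m

  vanish : ∀ i → ¬ p ∣ i → counted i ≡ 0
  vanish i p∤i with p ∣? i
  ... | yes p∣i = ⊥-elim (p∤i p∣i)
  ... | no _    = refl

  onMultiples : ∀ j → counted (j * p) ≡ coprimeTo m j
  onMultiples j = indicator-⇔ (coprime-∣ˡ (m∣m*n p) ∘ proj₂)
    (λ c → n∣m*n j , Coprimality.sym (coprime-* (Coprimality.sym c) (prime-∤⇒coprime p-prime p∤m)))
    (p ∣? j * p ×-dec coprime? (j * p) m) (coprime? j m)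

φ-prime*-∤ : ∀ {p m} → Prime p → ¬ p ∣ m → φ (p * m) ≡ (p ∸ 1) * φ m
φ-prime*-∤ {p} {m} p-prime p∤m = begin
  φ (p * m)                            ≡⟨ φ≡sumFrom (p * m) ⟩
  coprimes                             ≡⟨ sym (m+n∸n≡m coprimes (φ m)) ⟩
  coprimes + φ m ∸ φ m                 ≡⟨ cong (_∸ φ m) split ⟩
  p * φ m ∸ φ m                        ≡⟨ cong (p * φ m ∸_) (sym (*-identityˡ (φ m))) ⟩
  p * φ m ∸ 1 * φ m                    ≡⟨ sym (*-distribʳ-∸ (φ m) p 1) ⟩
  (p ∸ 1) * φ m                        ∎
  where
  open ≡-Reasoning
  coprimes = sumFrom (coprimeTo (p * m)) 0 (p * m)

  split : coprimes + φ m ≡ p * φ m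
  split = begin
    coprimes + φ m
      ≡⟨ cong (coprimes +_) (sym (sumFrom-coprimeMultipleOf p-prime p∤m)) ⟩
    coprimes + sumFrom (coprimeMultipleOf p m) 0 (p * m)
      ≡⟨ sym (sumFrom-+-pointwise (coprimeTo-split p-prime) 0 (p * m)) ⟩
    sumFrom (coprimeTo m) 0 (p * m)
      ≡⟨ sumFrom-coprimeTo m p ⟩
    p * φ m ∎

φ≤ : ∀ n → φ n ≤ n
φ≤ n = subst (_≤ n) (sym (φ≡sumFrom n)) (sumFrom-≤ (λ i → indicator≤1 (coprime? i n)) 0 n)

φ-pos : ∀ {n} → 0 < n → 0 < φ n
φ-pos {suc n} _ = subst (0 <_) (sym (trans (φ≡sumFrom (suc n)) (sumFrom-+ (coprimeTo (suc n)) 0 1 n)))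
                         (≤-trans coprime-to-1 (m≤m+n _ _))
  where
  coprime-to-1 : 0 < coprimeTo (suc n) 1
  coprime-to-1 with coprime? 1 (suc n)
  ... | yes _ = ≤-refl
  ... | no ¬c = ⊥-elim (¬c (Coprimality.1-coprimeTo (suc n)))

φ-2^*-odd : ∀ b {o} → ¬ 2 ∣ o → φ (2 ^ suc b * o) ≡ 2 ^ b * φ o
φ-2^*-odd zero    {o} 2∤o =
  trans (cong φ (trans (*-assoc 2 1 o) (cong (2 *_) (*-identityˡ o)))) (φ-prime*-∤ prime[2] 2∤o)
φ-2^*-odd (suc b) {o} 2∤o = begin
  φ (2 * 2 ^ suc b * o)      ≡⟨ cong φ (*-assoc 2 (2 ^ suc b) o) ⟩
  φ (2 * (2 ^ suc b * o))    ≡⟨ φ-prime*-∣ prime[2] (∣m⇒∣m*n o (m∣m*n (2 ^ b))) ⟩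
  2 * φ (2 ^ suc b * o)      ≡⟨ cong (2 *_) (φ-2^*-odd b 2∤o) ⟩
  2 * (2 ^ b * φ o)          ≡⟨ sym (*-assoc 2 (2 ^ b) (φ o)) ⟩
  2 ^ suc b * φ o            ∎
  where open ≡-Reasoning

-- Powers of two and Fermat numbers

∣2^⇒≡2^ : ∀ K {d} → d ∣ 2 ^ K → ∃ λ j → d ≡ 2 ^ j
∣2^⇒≡2^ zero    d∣1 = 0 , ∣1⇒≡1 d∣1
∣2^⇒≡2^ (suc K) {d} d∣2^[1+K] with 2 ∣? d
... | yes (divides q refl) =
  let j , q≡2^j = ∣2^⇒≡2^ K {q} (*-cancelˡ-∣ 2 (subst (_∣ 2 ^ suc K) (*-comm q 2) d∣2^[1+K]))
  in suc j , trans (*-comm q 2) (cong (2 *_) q≡2^j)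
... | no 2∤d = ∣2^⇒≡2^ K (coprime-divisor (prime-∤⇒coprime prime[2] 2∤d) d∣2^[1+K])

odd⇒≡1+[t+t] : ∀ n → ¬ 2 ∣ n → ∃ λ t → n ≡ suc (t + t)
odd⇒≡1+[t+t] zero          2∤0   = ⊥-elim (2∤0 (divides 0 refl))
odd⇒≡1+[t+t] (suc zero)    _     = 0 , refl
odd⇒≡1+[t+t] (suc (suc n)) 2∤2+n =
  let t , n≡1+2t = odd⇒≡1+[t+t] n (2∤2+n ∘ ∣m∣n⇒∣m+n ∣-refl)
  in suc t , cong (2 +_) (trans n≡1+2t (sym (+-suc t t)))

oddPart : ∀ y → 0 < y → ∃ λ b → ∃ λ o → y ≡ 2 ^ b * o × ¬ 2 ∣ o
oddPart = <-rec _ go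
  where
  go : ∀ y → (∀ {y′} → y′ < y → 0 < y′ → ∃ λ b → ∃ λ o → y′ ≡ 2 ^ b * o × ¬ 2 ∣ o) →
       0 < y → ∃ λ b → ∃ λ o → y ≡ 2 ^ b * o × ¬ 2 ∣ o
  go y rec 0<y with 2 ∣? y
  ... | no 2∤y = 0 , y , sym (*-identityˡ y) , 2∤y
  go .(q * 2) rec 0<q*2 | yes (divides q@(suc _) refl) =
    let b , o , q≡2^b*o , 2∤o = rec (m<m*n q 2 ≤-refl) z<s
    in suc b , o , trans (*-comm q 2) (trans (cong (2 *_) q≡2^b*o) (sym (*-assoc 2 (2 ^ b) o))) , 2∤o

2^-cancel-< : ∀ {a b} → 2 ^ a < 2 ^ b → a < b
2^-cancel-< {a} {b} 2^a<2^b with a <? b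
... | yes a<b = a<b
... | no a≮b  = ⊥-elim (<⇒≱ 2^a<2^b (^-monoʳ-≤ 2 (≮⇒≥ a≮b)))

n<2^n : ∀ n → n < 2 ^ n
n<2^n zero    = z<s
n<2^n (suc n) = +-mono-≤ (m^n>0 2 n) (subst (n <_) (sym (+-identityʳ (2 ^ n))) (n<2^n n))

2^2^ : ℕ → ℕ
2^2^ l = 2 ^ (2 ^ l)

2≤2^2^ : ∀ l → 2 ≤ 2^2^ l
2≤2^2^ l = ^-monoʳ-≤ 2 (m^n>0 2 l)

2^2^-suc : ∀ l → 2^2^ (suc l) ≡ 2^2^ l * 2^2^ l
2^2^-suc l = trans (cong (2 ^_) (cong (2 ^ l +_) (+-identityʳ (2 ^ l)))) (^-distribˡ-+-* 2 (2 ^ l) (2 ^ l))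

2^2^-cancel-< : ∀ l L → 2^2^ l + 1 < 2^2^ L + 1 → l < L
2^2^-cancel-< l L lt = 2^-cancel-< (2^-cancel-< (+-cancelʳ-< _ (2^2^ l) (2^2^ L) lt))

2^2^-square≤ : ∀ L l → L < l → 2^2^ L * 2^2^ L ≤ 2^2^ l
2^2^-square≤ L l L<l = subst (_≤ _) (2^2^-suc L) (^-monoʳ-≤ 2 (^-monoʳ-≤ 2 L<l))

fermat∣2^2^∸1 : ∀ {l} L → l < L → 2^2^ l + 1 ∣ 2^2^ L ∸ 1
fermat∣2^2^∸1 {l} (suc L) l<1+L = subst (2^2^ l + 1 ∣_) (sym factor) (by-cases (m<1+n⇒m<n∨m≡n l<1+L))
  where
  x = 2^2^ L
  factor : 2^2^ (suc L) ∸ 1 ≡ (x ∸ 1) * (x + 1)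
  factor with x | 2≤2^2^ L | 2^2^-suc L
  ... | suc y | _ | e = trans (cong (_∸ 1) e) (difference-of-squares y)
    where
    difference-of-squares : ∀ y → y + y * suc y ≡ y * (suc y + 1)
    difference-of-squares = solve-∀
  by-cases : l < L ⊎ l ≡ L → 2^2^ l + 1 ∣ (x ∸ 1) * (x + 1)
  by-cases (inj₁ l<L)  = ∣m⇒∣m*n (x + 1) (fermat∣2^2^∸1 L l<L)
  by-cases (inj₂ refl) = n∣m*n (x ∸ 1)

1+x∣x^odd+1 : ∀ x t → suc x ∣ x ^ suc (t + t) + 1
1+x∣x^odd+1 x       zero    = ∣-reflexive (sym (trans (cong (_+ 1) (*-identityʳ x)) (+-comm x 1)))
1+x∣x^odd+1 zero    (suc t) = 1∣ _
1+x∣x^odd+1 (suc y) (suc t) =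
  ∣m+n∣m⇒∣n (subst (suc x ∣_) (sym identity) (∣n⇒∣m*n x (∣n⇒∣m*n x ih))) (n∣m*n y)
  where
  x = suc y
  z = x ^ suc (t + t)
  ih : suc x ∣ z + 1
  ih = 1+x∣x^odd+1 x t
  identity : y * suc x + (x ^ suc (suc t + suc t) + 1) ≡ x * (x * (z + 1))
  identity = trans (cong (λ e → y * suc x + (x ^ e + 1)) (cong (2 +_) (+-suc t t)))
                   (square-step y z)
    where
    square-step : ∀ y z → y * suc (suc y) + (suc y * (suc y * z) + 1) ≡ suc y * (suc y * (z + 1))
    square-step = solve-∀

x<x^[2+n] : ∀ {x} n → 1 < x → x < x ^ suc (suc n)
x<x^[2+n] {x} n 1<x = subst (_< x ^ suc (suc n)) (*-identityʳ x) (^-monoʳ-< x 1<x {1} {suc (suc n)} (s<s z<s))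

prime-x^odd+1⇒exponent≡1 : ∀ {x} t → 1 < x → Prime (x ^ suc (t + t) + 1) → t ≡ 0
prime-x^odd+1⇒exponent≡1         zero    _   _       = refl
prime-x^odd+1⇒exponent≡1 {x} (suc t) 1<x p-prime with prime⇒irreducible p-prime (1+x∣x^odd+1 x (suc t))
... | inj₁ 1+x≡1 = ⊥-elim (<⇒≢ (<-trans z<s 1<x) (sym (suc-injective 1+x≡1)))
... | inj₂ 1+x≡p = ⊥-elim (<⇒≢ (x<x^[2+n] (t + suc t) 1<x) (suc-injective (trans 1+x≡p (+-comm _ 1))))

prime-2^+1⇒fermatPrime : ∀ {p j} → Prime p → p ≡ 2 ^ j + 1 → 0 < j → FermatPrime p
prime-2^+1⇒fermatPrime {j = j} p-prime refl 0<j with oddPart j 0<j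
... | l , o , j≡2^l*o , 2∤o with odd⇒≡1+[t+t] o 2∤o
...   | t , refl with prime-x^odd+1⇒exponent≡1 t (2≤2^2^ l)
                      (subst (λ e → Prime (e + 1))
                        (trans (cong (2 ^_) j≡2^l*o) (sym (^-*-assoc 2 (2 ^ l) (suc (t + t))))) p-prime)
...     | refl = p-prime , l , cong (λ e → 2 ^ e + 1) (trans j≡2^l*o (*-identityʳ (2 ^ l)))

2∣2^ : ∀ {n} → 0 < n → 2 ∣ 2 ^ n
2∣2^ {suc n} _ = m∣m*n (2 ^ n)

fermatPrime-odd : ∀ {p} → FermatPrime p → ¬ 2 ∣ p
fermatPrime-odd (_ , l , refl) 2∣p = <⇒≢ (s<s z<s) (sym (∣1⇒≡1 (∣m+n∣m⇒∣n 2∣p (2∣2^ (m^n>0 2 l)))))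

fermatPrime≥3 : ∀ {p} → FermatPrime p → 3 ≤ p
fermatPrime≥3 (_ , l , refl) = +-monoˡ-≤ 1 (2≤2^2^ l)

fermatPrime? : Decidable FermatPrime
fermatPrime? p = prime? p ×-dec map′ forget bound (anyUpTo? (λ l → p ≟ 2^2^ l + 1) p)
  where
  forget : (∃ λ l → l < p × p ≡ 2^2^ l + 1) → ∃ λ l → p ≡ 2^2^ l + 1
  forget (l , _ , e) = l , e
  bound : (∃ λ l → p ≡ 2^2^ l + 1) → ∃ λ l → l < p × p ≡ 2^2^ l + 1
  bound (l , refl) = l , ≤-trans (<-trans (n<2^n l) (n<2^n (2 ^ l))) (m≤m+n _ 1) , refl

least : ∀ {P : Pred ℕ 0ℓ} → Decidable P → ∀ {n} → P n → ∃ λ m → P m × (∀ {k} → P k → m ≤ k)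
least {P} P? {n} = <-rec (λ n → P n → ∃ λ m → P m × (∀ {k} → P k → m ≤ k)) go n
  where
  go : ∀ n → (∀ {n′} → n′ < n → P n′ → ∃ λ m → P m × (∀ {k} → P k → m ≤ k)) →
       P n → ∃ λ m → P m × (∀ {k} → P k → m ≤ k)
  go n rec Pn with anyUpTo? P? n
  ... | yes (n′ , n′<n , Pn′) = rec n′<n Pn′
  ... | no none               = n , Pn , λ {k} Pk → ≮⇒≥ (λ k<n → none (k , k<n , Pk))

-- The sequence of Fermat primes

FermatNo⇒FermatPrime : ∀ {j p} → FermatNo j p → FermatPrime p
FermatNo⇒FermatPrime (first fp _)    = fp
FermatNo⇒FermatPrime (next _ fp _ _) = fp

FermatNo-unique : ∀ {j p p′} → FermatNo j p → FermatNo j p′ → p ≡ p′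
FermatNo-unique (first fp least)     (first fp′ least′)      = ≤-antisym (least _ fp′) (least′ _ fp)
FermatNo-unique (next d fp lt least) (next d′ fp′ lt′ least′) with FermatNo-unique d d′
... | refl = ≤-antisym (least _ fp′ lt′) (least′ _ fp lt)
FermatNo-unique (first _ _) (next () _ _ _)
FermatNo-unique (next () _ _ _) (first _ _)

FermatNo-strictMono : ∀ {i j p p′} → FermatNo i p → FermatNo j p′ → i < j → p < p′
FermatNo-strictMono () (first _ _) (s<s z≤n)
FermatNo-strictMono d (next d′ _ p″<p′ _) i<j with m<1+n⇒m<n∨m≡n i<j
... | inj₁ i<j′ = <-trans (FermatNo-strictMono d d′ i<j′) p″<p′
... | inj₂ refl = subst (_< _) (FermatNo-unique d′ d) p″<p′

FermatNo-below : ∀ {j x r} → FermatNo j x → FermatPrime r → r ≤ x → ∃ λ i → i ≤ j × FermatNo i r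
FermatNo-below d@(first fp least) fr r≤x with ≤-antisym r≤x (least _ fr)
... | refl = 1 , ≤-refl , d
FermatNo-below {r = r} d@(next {p = x′} d′ _ _ least) fr r≤x with r ≤? x′
... | yes r≤x′ = let i , i≤j , dᵢ = FermatNo-below d′ fr r≤x′ in i , m≤n⇒m≤1+n i≤j , dᵢ
... | no r≰x′ with ≤-antisym r≤x (least r fr (≰⇒> r≰x′))
...   | refl = _ , ≤-refl , d

FermatNo-next : ∀ {j x r} → FermatNo j x → FermatPrime r → x < r → ∃ λ q → FermatNo (suc j) q
FermatNo-next {x = x} d fr x<r with least (λ r → fermatPrime? r ×-dec x <? r) (fr , x<r)
... | q , (fq , x<q) , minimal = q , next d fq x<q (λ r fr x<r → minimal (fr , x<r))

FermatNo-1-3 : FermatNo 1 3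
FermatNo-1-3 = first (from-yes (prime? 3) , 0 , refl) (λ _ → fermatPrime≥3)

-- Products of distinct primes

SquareFree : ℕ → Set
SquareFree n = ∀ {p} → Prime p → p ∣ n → ∃ λ c → n ≡ p * c × ¬ p ∣ c

prime∣prime⇒≡ : ∀ {p q} → Prime p → Prime q → p ∣ q → p ≡ q
prime∣prime⇒≡ p-prime q-prime p∣q with prime⇒irreducible q-prime p∣q
... | inj₁ p≡1 = ⊥-elim (prime≢1 p-prime p≡1)
... | inj₂ p≡q = p≡q

coprime∧∣⇒*∣ : ∀ {a b n} → Coprime a b → a ∣ n → b ∣ n → a * b ∣ n
coprime∧∣⇒*∣ {a} {b} coprime a∣n (divides q refl) with coprime-divisor coprime (subst (a ∣_) (*-comm q b) a∣n)
... | divides r refl = divides r (*-assoc r a b)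

DistinctPrimes : ∀ {k} → (Fin k → ℕ) → Set
DistinctPrimes G = (∀ i → Prime (G i)) × Injective _≡_ _≡_ G

distinctPrimes-tail : ∀ {k} {G : Fin (suc k) → ℕ} → DistinctPrimes G → DistinctPrimes (G ∘ suc)
distinctPrimes-tail (G-prime , G-injective) = G-prime ∘ suc , Finₚ.suc-injective ∘ G-injective

∣prodFin : ∀ k (G : Fin k → ℕ) j → G j ∣ prodFin k G
∣prodFin (suc k) G zero    = m∣m*n _
∣prodFin (suc k) G (suc j) = ∣n⇒∣m*n (G zero) (∣prodFin k (G ∘ suc) j)

prime∣prodFin : ∀ k (G : Fin k → ℕ) → (∀ i → Prime (G i)) →
                ∀ {p} → Prime p → p ∣ prodFin k G → ∃ λ i → p ≡ G i
prime∣prodFin zero    G _       p-prime p∣1 = ⊥-elim (prime≢1 p-prime (∣1⇒≡1 p∣1))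
prime∣prodFin (suc k) G G-prime p-prime p∣ with euclidsLemma (G zero) _ p-prime p∣
... | inj₁ p∣G₀ = zero , prime∣prime⇒≡ p-prime (G-prime zero) p∣G₀
... | inj₂ p∣tail = let i , p≡ = prime∣prodFin k (G ∘ suc) (G-prime ∘ suc) p-prime p∣tail in suc i , p≡

prodFin-odd : ∀ k (G : Fin k → ℕ) → (∀ i → ¬ 2 ∣ G i) → ¬ 2 ∣ prodFin k G
prodFin-odd zero    G _     2∣1 = <⇒≢ (s<s z<s) (sym (∣1⇒≡1 2∣1))
prodFin-odd (suc k) G G-odd 2∣ with euclidsLemma (G zero) _ prime[2] 2∣
... | inj₁ 2∣G₀   = G-odd zero 2∣G₀
... | inj₂ 2∣tail = prodFin-odd k (G ∘ suc) (G-odd ∘ suc) 2∣tail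

head∤prodFin-tail : ∀ k (G : Fin (suc k) → ℕ) → DistinctPrimes G → ¬ G zero ∣ prodFin k (G ∘ suc)
head∤prodFin-tail k G (G-prime , injective) G₀∣
  with prime∣prodFin k (G ∘ suc) (G-prime ∘ suc) (G-prime zero) G₀∣
... | i , G₀≡ with injective G₀≡
... | ()

prodFin-squareFree : ∀ k (G : Fin k → ℕ) → DistinctPrimes G → SquareFree (prodFin k G)
prodFin-squareFree zero    G _        p-prime p∣1 = ⊥-elim (prime≢1 p-prime (∣1⇒≡1 p∣1))
prodFin-squareFree (suc k) G distinct@(G-prime , injective) {p} p-prime p∣
  with euclidsLemma (G zero) (prodFin k (G ∘ suc)) p-prime p∣
... | inj₁ p∣G₀ with prime∣prime⇒≡ p-prime (G-prime zero) p∣G₀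
...   | refl = prodFin k (G ∘ suc) , refl , head∤prodFin-tail k G distinct
prodFin-squareFree (suc k) G distinct@(G-prime , injective) {p} p-prime p∣ | inj₂ p∣tail
  with prodFin-squareFree k (G ∘ suc) (distinctPrimes-tail distinct) p-prime p∣tail
... | c , tail≡p*c , p∤c = G zero * c , trans (cong (G zero *_) tail≡p*c) (x∙yz≈y∙xz (G zero) p c) , p∤G₀*c
  where
  p∤G₀*c : ¬ p ∣ G zero * c
  p∤G₀*c p∣G₀*c with euclidsLemma (G zero) c p-prime p∣G₀*c
  ... | inj₂ p∣c  = p∤c p∣c
  ... | inj₁ p∣G₀ with prime∣prodFin k (G ∘ suc) (G-prime ∘ suc) p-prime p∣tail
  ...   | i , p≡Gᵢ₊₁ with injective (trans (sym (prime∣prime⇒≡ p-prime (G-prime zero) p∣G₀)) p≡Gᵢ₊₁)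
  ...     | ()

prodFin∣ : ∀ k (G : Fin k → ℕ) → DistinctPrimes G → ∀ {n} → (∀ i → G i ∣ n) → prodFin k G ∣ n
prodFin∣ zero    G _        _   = 1∣ _
prodFin∣ (suc k) G distinct G∣n =
  coprime∧∣⇒*∣ (Coprimality.sym (prime-∤⇒coprime (proj₁ distinct zero) (head∤prodFin-tail k G distinct)))
               (G∣n zero) (prodFin∣ k (G ∘ suc) (distinctPrimes-tail distinct) (G∣n ∘ suc))

φ-prodFin : ∀ k (G : Fin k → ℕ) → DistinctPrimes G → φ (prodFin k G) ≡ prodFin k (λ i → G i ∸ 1)
φ-prodFin zero    G _        = refl
φ-prodFin (suc k) G distinct =
  trans (φ-prime*-∤ (proj₁ distinct zero) (head∤prodFin-tail k G distinct))
        (cong ((G zero ∸ 1) *_) (φ-prodFin k (G ∘ suc) (distinctPrimes-tail distinct)))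

prodFin-2^ : ∀ k (G : Fin k → ℕ) → (∀ i → ∃ λ e → G i ≡ 2 ^ e) → ∃ λ σ → prodFin k G ≡ 2 ^ σ
prodFin-2^ zero    G _     = 0 , refl
prodFin-2^ (suc k) G pow2 with pow2 zero | prodFin-2^ k (G ∘ suc) (pow2 ∘ suc)
... | e , G₀≡2^e | σ , tail≡2^σ =
  e + σ , trans (cong₂ _*_ G₀≡2^e tail≡2^σ) (sym (^-distribˡ-+-* 2 e σ))

-- Odd numbers whose totient is a power of two

-- φ is not shown multiplicative in general, so the splitting of φ F is recorded.
Cofactor : ℕ → ℕ → ℕ → Set
Cofactor F o c = o * c ≡ F × φ o * φ c ≡ φ F

cofactor-prime* : ∀ {F p g c} → SquareFree F → Prime p → p ∣ F → ¬ p ∣ g →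
                  Cofactor F g c → ∃ λ c′ → Cofactor F (p * g) c′
cofactor-prime* {F} {p} {g} sf p-prime p∣F p∤g (g*c≡F , φ-split)
  with euclidsLemma g _ p-prime (subst (p ∣_) (sym g*c≡F) p∣F)
... | inj₁ p∣g = ⊥-elim (p∤g p∣g)
... | inj₂ (divides c′ refl) with sf p-prime p∣F
...   | c₀ , F≡p*c₀ , p∤c₀ = c′ , trans (xy∙z≈y∙zx p g c′) g*c≡F , totient
  where
  open ≡-Reasoning
  p∤c′ : ¬ p ∣ c′
  p∤c′ p∣c′ = p∤c₀ (subst (p ∣_) g*c′≡c₀ (∣n⇒∣m*n g p∣c′))
    where
    g*c′≡c₀ : g * c′ ≡ c₀
    g*c′≡c₀ = *-cancelˡ-≡ _ _ p {{prime⇒nonZero p-prime}}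
      (trans (x∙yz≈y∙zx p g c′) (trans g*c≡F F≡p*c₀))
  totient : φ (p * g) * φ c′ ≡ φ F
  totient = begin
    φ (p * g) * φ c′          ≡⟨ cong (_* φ c′) (φ-prime*-∤ p-prime p∤g) ⟩
    (p ∸ 1) * φ g * φ c′      ≡⟨ xy∙z≈y∙zx (p ∸ 1) (φ g) (φ c′) ⟩
    φ g * (φ c′ * (p ∸ 1))    ≡⟨ cong (φ g *_) (*-comm (φ c′) (p ∸ 1)) ⟩
    φ g * ((p ∸ 1) * φ c′)    ≡⟨ cong (φ g *_) (sym (φ-prime*-∤ p-prime p∤c′)) ⟩
    φ g * φ (p * c′)          ≡⟨ cong (λ x → φ g * φ x) (*-comm p c′) ⟩
    φ g * φ (c′ * p)          ≡⟨ φ-split ⟩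
    φ F                       ∎

data Decomposition (F : ℕ) (extra : Maybe ℕ) (o : ℕ) : Set where
  inside    : ∀ {c} → Cofactor F o c → Decomposition F extra o
  withExtra : ∀ {q g c} → extra ≡ just q → o ≡ q * g → φ o ≡ (q ∸ 1) * φ g → Cofactor F g c →
              Decomposition F extra o

odd-prime∤2^ : ∀ {p} K → Prime p → ¬ 2 ∣ p → ¬ p ∣ 2 ^ K
odd-prime∤2^ K p-prime 2∤p p∣2^K with ∣2^⇒≡2^ K p∣2^K
... | zero  , p≡1     = prime≢1 p-prime p≡1
... | suc j , p≡2^1+j = 2∤p (subst (2 ∣_) (sym p≡2^1+j) (2∣2^ {suc j} z<s))

odd-prime-pred∣2^⇒fermatPrime : ∀ {p} K → Prime p → ¬ 2 ∣ p → p ∸ 1 ∣ 2 ^ K → FermatPrime p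
odd-prime-pred∣2^⇒fermatPrime K p-prime 2∤p p-1∣2^K with ∣2^⇒≡2^ K p-1∣2^K
... | zero  , p-1≡1   = ⊥-elim (2∤p (∣-reflexive (trans (cong (_+ 1) (sym p-1≡1)) (prime-pred+1 p-prime))))
... | suc j , p-1≡2^j = prime-2^+1⇒fermatPrime {j = suc j} p-prime
                          (trans (sym (prime-pred+1 p-prime)) (cong (_+ 1) p-1≡2^j)) z<s

primeFactor : ∀ n → 1 < n → ∃ λ p → ∃ λ m → Prime p × n ≡ p * m
primeFactor 1 (s<s ())
primeFactor n@(suc (suc _)) _ with factorise n
... | record { factors = p ∷ ps ; isFactorisation = n≡ ; factorsPrime = p-prime ∷ _ } =
  p , product ps , p-prime , n≡

-- The last alternative rules p out of every o with φ o ∣ 2 ^ K, as p ∸ 1 would divide φ o.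
module _ (F : ℕ) (F-squareFree : SquareFree F) (K : ℕ) (extra : Maybe ℕ)
         (fermat-cover : ∀ {p} → FermatPrime p → p ∣ F ⊎ extra ≡ just p ⊎ 2 ^ K < p ∸ 1) where

  decomposition-prime* : ∀ {p m} → FermatPrime p → ¬ p ∣ m → φ (p * m) ∣ 2 ^ K →
                         Decomposition F extra m → Decomposition F extra (p * m)
  decomposition-prime* {p} {m} fp@(p-prime , _) p∤m φ∣2^K dₘ with fermat-cover fp | dₘ
  ... | inj₁ p∣F | inside cof = inside (proj₂ (cofactor-prime* F-squareFree p-prime p∣F p∤m cof))
  ... | inj₁ p∣F | withExtra {q} {g} e refl φm cof =
    withExtra e (x∙yz≈y∙xz p q g) φ-eq (proj₂ (cofactor-prime* F-squareFree p-prime p∣F p∤g cof))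
    where
    p∤g : ¬ p ∣ g
    p∤g = p∤m ∘ ∣n⇒∣m*n q
    φ-eq : φ (p * (q * g)) ≡ (q ∸ 1) * φ (p * g)
    φ-eq = begin
      φ (p * (q * g))               ≡⟨ φ-prime*-∤ p-prime p∤m ⟩
      (p ∸ 1) * φ (q * g)           ≡⟨ cong ((p ∸ 1) *_) φm ⟩
      (p ∸ 1) * ((q ∸ 1) * φ g)     ≡⟨ x∙yz≈y∙xz (p ∸ 1) (q ∸ 1) (φ g) ⟩
      (q ∸ 1) * ((p ∸ 1) * φ g)     ≡⟨ cong ((q ∸ 1) *_) (sym (φ-prime*-∤ p-prime p∤g)) ⟩
      (q ∸ 1) * φ (p * g)           ∎
      where open ≡-Reasoning
  ... | inj₂ (inj₁ e) | inside cof = withExtra e refl (φ-prime*-∤ p-prime p∤m) cof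
  ... | inj₂ (inj₁ e) | withExtra e′ refl _ _ with just-injective (trans (sym e′) e)
  ...   | refl = ⊥-elim (p∤m (m∣m*n _))
  decomposition-prime* {p} {m} fp@(p-prime , _) p∤m φ∣2^K dₘ | inj₂ (inj₂ 2^K<p-1) | _ =
    ⊥-elim (<⇒≱ 2^K<p-1 (∣⇒≤ {{>-nonZero (m^n>0 2 K)}} (∣-trans p-1∣φ φ∣2^K)))
    where
    p-1∣φ : p ∸ 1 ∣ φ (p * m)
    p-1∣φ = subst (p ∸ 1 ∣_) (sym (φ-prime*-∤ p-prime p∤m)) (m∣m*n (φ m))

  decompose : ∀ o → 0 < o → ¬ 2 ∣ o → φ o ∣ 2 ^ K → Decomposition F extra o
  decompose = <-rec _ go
    where
    go : ∀ o → (∀ {o′} → o′ < o → 0 < o′ → ¬ 2 ∣ o′ → φ o′ ∣ 2 ^ K → Decomposition F extra o′) →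
         0 < o → ¬ 2 ∣ o → φ o ∣ 2 ^ K → Decomposition F extra o
    go o rec 0<o 2∤o φₒ∣2^K with m≤n⇒m<n∨m≡n 0<o
    ... | inj₂ refl = inside (*-identityˡ F , +-identityʳ (φ F))
    ... | inj₁ 1<o with primeFactor o 1<o
    ...   | p , m , p-prime , refl with p ∣? m
    ...   | yes p∣m = ⊥-elim (odd-prime∤2^ K p-prime (2∤o ∘ ∣m⇒∣m*n m)
                        (∣-trans (subst (p ∣_) (sym (φ-prime*-∣ p-prime p∣m)) (m∣m*n (φ m))) φₒ∣2^K))
    ...   | no p∤m = decomposition-prime* fp p∤m φₒ∣2^K
                       (rec m<o 0<m (2∤o ∘ ∣n⇒∣m*n p) (∣-trans φₘ∣φₒ φₒ∣2^K))
      where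
      φₒ≡ : φ (p * m) ≡ (p ∸ 1) * φ m
      φₒ≡ = φ-prime*-∤ p-prime p∤m
      φₘ∣φₒ : φ m ∣ φ (p * m)
      φₘ∣φₒ = subst (φ m ∣_) (sym φₒ≡) (n∣m*n (p ∸ 1))
      fp : FermatPrime p
      fp = odd-prime-pred∣2^⇒fermatPrime K p-prime (2∤o ∘ ∣m⇒∣m*n m)
             (∣-trans (subst (p ∸ 1 ∣_) (sym φₒ≡) (m∣m*n (φ m))) φₒ∣2^K)
      0<m : 0 < m
      0<m = >-nonZero⁻¹ m {{m*n≢0⇒n≢0 p {{>-nonZero 0<o}}}}
      m<o : m < p * m
      m<o = subst (_< p * m) (*-identityˡ m) (*-monoˡ-< m {{>-nonZero 0<m}} (prime>1 p-prime))

-- Maximal preimages of the totient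

odd⇒>0 : ∀ {o} → ¬ 2 ∣ o → 0 < o
odd⇒>0 2∤o = n≢0⇒n>0 λ { refl → 2∤o (divides 0 refl) }

InN₂-intro : ∀ x → (∀ y → φ y ≡ φ x → y ≤ x) → InN₂ x
InN₂-intro x maximal = φ x , (x , refl) , refl , maximal

maximal-from-oddParts : ∀ a {F} → ¬ 2 ∣ F →
  (∀ b {o} → ¬ 2 ∣ o → 2 ^ b * φ o ≡ 2 ^ a * φ F → 2 ^ b * o ≤ 2 ^ a * F) →
  ∀ y → φ y ≡ φ (2 ^ suc a * F) → y ≤ 2 ^ suc a * F
maximal-from-oddParts a         2∤F bound zero      _   = z≤n
maximal-from-oddParts a {F} 2∤F bound y@(suc _) φy≡ with oddPart y z<s
... | b , o , y≡2^b*o , 2∤o = subst (_≤ 2 ^ suc a * F) (sym y≡2^b*o)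
      (bound′ b 2∤o (trans (cong φ (sym y≡2^b*o)) (trans φy≡ (φ-2^*-odd a 2∤F))))
  where
  open ≤-Reasoning
  bound′ : ∀ b {o} → ¬ 2 ∣ o → φ (2 ^ b * o) ≡ 2 ^ a * φ F → 2 ^ b * o ≤ 2 ^ suc a * F
  bound′ zero {o} 2∤o φ≡ = begin
    1 * o             ≤⟨ bound 0 2∤o (trans (*-identityˡ (φ o)) (trans (cong φ (sym (*-identityˡ o))) φ≡)) ⟩
    2 ^ a * F         ≤⟨ m≤n*m (2 ^ a * F) 2 ⟩
    2 * (2 ^ a * F)   ≡⟨ *-assoc 2 (2 ^ a) F ⟨
    2 ^ suc a * F     ∎
  bound′ (suc b) {o} 2∤o φ≡ = begin
    2 * 2 ^ b * o     ≡⟨ *-assoc 2 (2 ^ b) o ⟩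
    2 * (2 ^ b * o)   ≤⟨ *-monoʳ-≤ 2 (bound b 2∤o (trans (sym (φ-2^*-odd b 2∤o)) φ≡)) ⟩
    2 * (2 ^ a * F)   ≡⟨ *-assoc 2 (2 ^ a) F ⟨
    2 ^ suc a * F     ∎

cofactor-bound : ∀ {F o c} x y → 0 < o → Cofactor F o c → y * φ o ≡ x * φ F → y * o ≤ x * F
cofactor-bound {F} {o} {c} x y 0<o (o*c≡F , φ-split) y*φo≡ = begin
  y * o             ≡⟨ cong (_* o) y≡x*φc ⟩
  x * φ c * o       ≤⟨ *-monoˡ-≤ o (*-monoʳ-≤ x (φ≤ c)) ⟩
  x * c * o         ≡⟨ xy∙z≈x∙zy x c o ⟩
  x * (o * c)       ≡⟨ cong (x *_) o*c≡F ⟩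
  x * F             ∎
  where
  open ≤-Reasoning
  y≡x*φc : y ≡ x * φ c
  y≡x*φc = *-cancelʳ-≡ y (x * φ c) (φ o) {{>-nonZero (φ-pos 0<o)}}
    (trans y*φo≡ (trans (cong (x *_) (sym φ-split)) (sym (xy∙z≈x∙zy x (φ c) (φ o)))))

φ-prime*≤ : ∀ {p} → Prime p → ∀ t → φ (p * t) ≤ (p ∸ 1) * t
φ-prime*≤ {p} p-prime = <-rec _ go
  where
  go : ∀ t → (∀ {t′} → t′ < t → φ (p * t′) ≤ (p ∸ 1) * t′) → φ (p * t) ≤ (p ∸ 1) * t
  go t rec with p ∣? t
  ... | no p∤t = subst (_≤ (p ∸ 1) * t) (sym (φ-prime*-∤ p-prime p∤t)) (*-monoʳ-≤ (p ∸ 1) (φ≤ t))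
  ... | yes (divides zero refl) = subst (λ n → φ n ≤ (p ∸ 1) * 0) (sym (*-zeroʳ p)) z≤n
  ... | yes (divides t′@(suc _) refl) = begin
    φ (p * (t′ * p))       ≡⟨ φ-prime*-∣ p-prime (n∣m*n t′) ⟩
    p * φ (t′ * p)         ≡⟨ cong (λ n → p * φ n) (*-comm t′ p) ⟩
    p * φ (p * t′)         ≤⟨ *-monoʳ-≤ p (rec t′<t) ⟩
    p * ((p ∸ 1) * t′)     ≡⟨ x∙yz≈y∙zx p (p ∸ 1) t′ ⟩
    (p ∸ 1) * (t′ * p)     ∎
    where
    open ≤-Reasoning
    t′<t : t′ < t′ * p
    t′<t = m<m*n t′ p (prime>1 p-prime)

q*[p∸1]≤[q∸1]*p : ∀ {p q} → 0 < p → p ≤ q → q * (p ∸ 1) ≤ (q ∸ 1) * p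
q*[p∸1]≤[q∸1]*p {suc p} {suc q} _ (s≤s p≤q) = begin
  suc q * p       ≡⟨ +-comm p (q * p) ⟩
  q * p + p       ≤⟨ +-monoʳ-≤ (q * p) p≤q ⟩
  q * p + q       ≡⟨ +-comm (q * p) q ⟩
  q + q * p       ≡⟨ *-suc q p ⟨
  q * suc p       ∎
  where open ≤-Reasoning

-- For a prime factor p ≤ q of c, φ c / c ≤ (p − 1) / p ≤ (q − 1) / q.
ratio-bound : ∀ {q c} x y → x < q ∸ 1 → (∀ {p} → Prime p → p ∣ c → p ≤ q) →
              y * (q ∸ 1) ≡ x * φ c → y * q ≤ x * c
ratio-bound         x zero       _     _     _ = z≤n
ratio-bound {q} {c} x y@(suc _) x<q-1 small y*[q-1]≡ with 1 <? c
... | no 1≮c = ⊥-elim (<⇒≱ x<q-1 (begin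
  q ∸ 1             ≤⟨ m≤n*m (q ∸ 1) y ⟩
  y * (q ∸ 1)       ≡⟨ y*[q-1]≡ ⟩
  x * φ c           ≤⟨ *-monoʳ-≤ x (≤-trans (φ≤ c) (≮⇒≥ 1≮c)) ⟩
  x * 1             ≡⟨ *-identityʳ x ⟩
  x                 ∎))
  where open ≤-Reasoning
... | yes 1<c with primeFactor c 1<c
...   | p , t , p-prime , refl =
  *-cancelʳ-≤ (y * q) (x * (p * t)) (q ∸ 1) {{>-nonZero (≤-<-trans z≤n x<q-1)}} (begin
  y * q * (q ∸ 1)               ≡⟨ rearrange₁ y q (q ∸ 1) ⟩
  q * (y * (q ∸ 1))             ≡⟨ cong (q *_) y*[q-1]≡ ⟩
  q * (x * φ (p * t))           ≤⟨ *-monoʳ-≤ q (*-monoʳ-≤ x (φ-prime*≤ p-prime t)) ⟩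
  q * (x * ((p ∸ 1) * t))       ≡⟨ rearrange₂ q x (p ∸ 1) t ⟩
  x * t * (q * (p ∸ 1))         ≤⟨ *-monoʳ-≤ (x * t) (q*[p∸1]≤[q∸1]*p (<⇒≤ (prime>1 p-prime)) p≤q) ⟩
  x * t * ((q ∸ 1) * p)         ≡⟨ rearrange₃ x t (q ∸ 1) p ⟩
  x * (p * t) * (q ∸ 1)         ∎)
  where
  open ≤-Reasoning
  p≤q : p ≤ q
  p≤q = small p-prime (m∣m*n t)
  rearrange₁ : ∀ y q r → y * q * r ≡ q * (y * r)
  rearrange₁ = solve-∀
  rearrange₂ : ∀ q x r t → q * (x * (r * t)) ≡ x * t * (q * r)
  rearrange₂ = solve-∀
  rearrange₃ : ∀ x t s p → x * t * (s * p) ≡ x * (p * t) * s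
  rearrange₃ = solve-∀

extra-bound : ∀ {F q g c} x y → 0 < g → x < q ∸ 1 → (∀ {p} → Prime p → p ∣ c → p ≤ q) →
              Cofactor F g c → y * ((q ∸ 1) * φ g) ≡ x * φ F → y * (q * g) ≤ x * F
extra-bound {F} {q} {g} {c} x y 0<g x<q-1 small (g*c≡F , φ-split) y*φo≡ = begin
  y * (q * g)       ≡⟨ *-assoc y q g ⟨
  y * q * g         ≤⟨ *-monoˡ-≤ g (ratio-bound x y x<q-1 small y*[q-1]≡x*φc) ⟩
  x * c * g         ≡⟨ xy∙z≈x∙zy x c g ⟩
  x * (g * c)       ≡⟨ cong (x *_) g*c≡F ⟩
  x * F             ∎
  where
  open ≤-Reasoning
  y*[q-1]≡x*φc : y * (q ∸ 1) ≡ x * φ c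
  y*[q-1]≡x*φc = *-cancelʳ-≡ _ _ (φ g) {{>-nonZero (φ-pos 0<g)}} (begin-equality
    y * (q ∸ 1) * φ g       ≡⟨ *-assoc y (q ∸ 1) (φ g) ⟩
    y * ((q ∸ 1) * φ g)     ≡⟨ y*φo≡ ⟩
    x * φ F                 ≡⟨ cong (x *_) φ-split ⟨
    x * (φ g * φ c)         ≡⟨ x∙yz≈x∙zy x (φ g) (φ c) ⟩
    x * (φ c * φ g)         ≡⟨ *-assoc x (φ c) (φ g) ⟨
    x * φ c * φ g           ∎)

-- The first k Fermat primes

module FirstFermatPrimes (k : ℕ) (Fs : Fin k → ℕ) (Fs-fermat : ∀ i → FermatNo (suc (toℕ i)) (Fs i)) where

  F : ℕ
  F = prodFin k Fs

  fermatPrime : ∀ i → FermatPrime (Fs i)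
  fermatPrime = FermatNo⇒FermatPrime ∘ Fs-fermat

  distinct : DistinctPrimes Fs
  distinct = proj₁ ∘ fermatPrime , injective
    where
    injective : Injective _≡_ _≡_ Fs
    injective {i} {j} Fsᵢ≡Fsⱼ with <-cmp (toℕ i) (toℕ j)
    ... | tri< i<j _ _ = ⊥-elim (<⇒≢ (FermatNo-strictMono (Fs-fermat i) (Fs-fermat j) (s<s i<j)) Fsᵢ≡Fsⱼ)
    ... | tri≈ _ i≡j _ = Finₚ.toℕ-injective i≡j
    ... | tri> _ _ j<i = ⊥-elim (<⇒≢ (FermatNo-strictMono (Fs-fermat j) (Fs-fermat i) (s<s j<i)) (sym Fsᵢ≡Fsⱼ))

  F-odd : ¬ 2 ∣ F
  F-odd = prodFin-odd k Fs (fermatPrime-odd ∘ fermatPrime)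

  φF≡2^σ : ∃ λ σ → φ F ≡ 2 ^ σ
  φF≡2^σ = let σ , e = prodFin-2^ k (λ i → Fs i ∸ 1) pred-pow2 in σ , trans (φ-prodFin k Fs distinct) e
    where
    pred-pow2 : ∀ i → ∃ λ e → Fs i ∸ 1 ≡ 2 ^ e
    pred-pow2 i with fermatPrime i
    ... | _ , l , Fsᵢ≡ = 2 ^ l , trans (cong (_∸ 1) Fsᵢ≡) (m+n∸n≡m (2^2^ l) 1)

  ∣F : ∀ {i r} → FermatNo i r → i ≤ k → r ∣ F
  ∣F {suc i} d i<k = subst (_∣ F) (FermatNo-unique dᵢ d) (∣prodFin k Fs idx)
    where
    idx = fromℕ< i<k
    dᵢ : FermatNo (suc i) (Fs idx)
    dᵢ = subst (λ n → FermatNo (suc n) (Fs idx)) (Finₚ.toℕ-fromℕ< i<k) (Fs-fermat idx)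

  module _ (a : ℕ) (extra : Maybe ℕ)
    (fermat-cover : ∀ {p} → FermatPrime p → p ∣ F ⊎ extra ≡ just p ⊎ 2 ^ (a + proj₁ φF≡2^σ) < p ∸ 1)
    (extra-case : ∀ b {q g c} → extra ≡ just q → 0 < g → Cofactor F g c →
                    2 ^ b * ((q ∸ 1) * φ g) ≡ 2 ^ a * φ F → 2 ^ b * (q * g) ≤ 2 ^ a * F) where

    InN₂-2^[1+a]*F : InN₂ (2 ^ suc a * F)
    InN₂-2^[1+a]*F = InN₂-intro _ (maximal-from-oddParts a F-odd bound)
      where
      σ = proj₁ φF≡2^σ
      bound : ∀ b {o} → ¬ 2 ∣ o → 2 ^ b * φ o ≡ 2 ^ a * φ F → 2 ^ b * o ≤ 2 ^ a * F
      bound b {o} 2∤o e with decompose F (prodFin-squareFree k Fs distinct) (a + σ) extra fermat-cover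
                                   o (odd⇒>0 2∤o) 2∤o φo∣2^K
        where
        φo∣2^K : φ o ∣ 2 ^ (a + σ)
        φo∣2^K = divides (2 ^ b) (trans (^-distribˡ-+-* 2 a σ)
                   (trans (cong (2 ^ a *_) (sym (proj₂ φF≡2^σ))) (sym e)))
      ... | inside cof = cofactor-bound (2 ^ a) (2 ^ b) (odd⇒>0 2∤o) cof e
      ... | withExtra {q} {g} e′ refl φo cof =
        extra-case b e′ (>-nonZero⁻¹ g {{m*n≢0⇒n≢0 q {{>-nonZero (odd⇒>0 2∤o)}}}}) cof
                     (trans (cong (2 ^ b *_) (sym φo)) e)

  below-next⇒∣F : ∀ {p q} → FermatNo (suc k) q → FermatPrime p → p < q → p ∣ F
  below-next⇒∣F d fp p<q with FermatNo-below d fp (<⇒≤ p<q)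
  ... | i , i≤1+k , dₚ with m≤n⇒m<n∨m≡n i≤1+k
  ...   | inj₁ (s≤s i≤k) = ∣F dₚ i≤k
  ...   | inj₂ refl      = ⊥-elim (<⇒≢ p<q (FermatNo-unique dₚ d))

  module _ {L} (Fₖ₊₁ : FermatNo (suc k) (2^2^ L + 1)) where

    φF<2^2^L : φ F < 2^2^ L
    φF<2^2^L = begin-strict
      φ F             ≤⟨ φ≤ F ⟩
      F               ≤⟨ ∣⇒≤ {{>-nonZero (∸-monoˡ-< (2≤2^2^ L) ≤-refl)}} F∣2^2^L∸1 ⟩
      2^2^ L ∸ 1      <⟨ ∸-monoʳ-< z<s (<⇒≤ (2≤2^2^ L)) ⟩
      2^2^ L          ∎
      where
      open ≤-Reasoning
      F∣2^2^L∸1 : F ∣ 2^2^ L ∸ 1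
      F∣2^2^L∸1 = prodFin∣ k Fs distinct λ i → divides-pred i (fermatPrime i)
        (FermatNo-strictMono (Fs-fermat i) Fₖ₊₁ (s<s (Finₚ.toℕ<n i)))
        where
        divides-pred : ∀ i → FermatPrime (Fs i) → Fs i < 2^2^ L + 1 → Fs i ∣ 2^2^ L ∸ 1
        divides-pred i (_ , l , e) lt rewrite e = fermat∣2^2^∸1 L (2^2^-cancel-< l L lt)

    InN₂-below-next : ∀ a → 2 ^ suc a ≤ 2^2^ L + 1 ∸ 1 → InN₂ (2 ^ suc a * F)
    InN₂-below-next a 2^[1+a]≤ = InN₂-2^[1+a]*F a (just q) cover bound
      where
      q = 2^2^ L + 1
      σ = proj₁ φF≡2^σ

      2^a<q-1 : 2 ^ a < q ∸ 1
      2^a<q-1 = <-≤-trans (^-monoʳ-< 2 (s≤s (s≤s z≤n)) (n<1+n a)) 2^[1+a]≤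

      2^[a+σ]<2^2^L² : 2 ^ (a + σ) < 2^2^ L * 2^2^ L
      2^[a+σ]<2^2^L² = subst (_< 2^2^ L * 2^2^ L)
        (trans (cong (2 ^ a *_) (proj₂ φF≡2^σ)) (sym (^-distribˡ-+-* 2 a σ)))
        (*-mono-< (subst (2 ^ a <_) (m+n∸n≡m (2^2^ L) 1) 2^a<q-1) φF<2^2^L)

      cover : ∀ {p} → FermatPrime p → p ∣ F ⊎ just q ≡ just p ⊎ 2 ^ (a + σ) < p ∸ 1
      cover {p} fp with <-cmp p q
      ... | tri< p<q _ _ = inj₁ (below-next⇒∣F Fₖ₊₁ fp p<q)
      ... | tri≈ _ refl _ = inj₂ (inj₁ refl)
      ... | tri> _ _ q<p with fp
      ...   | _ , l , refl = inj₂ (inj₂ (<-≤-trans 2^[a+σ]<2^2^L²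
                (subst (2^2^ L * 2^2^ L ≤_) (sym (m+n∸n≡m (2^2^ l) 1)) (2^2^-square≤ L l (2^2^-cancel-< L l q<p)))))

      below-q : ∀ {g c} → Cofactor F g c → ∀ {p} → Prime p → p ∣ c → p ≤ q
      below-q {g} (g*c≡F , _) p-prime p∣c
        with prime∣prodFin k Fs (proj₁ distinct) p-prime (∣-trans p∣c (subst (_ ∣_) g*c≡F (n∣m*n g)))
      ... | i , refl = <⇒≤ (FermatNo-strictMono (Fs-fermat i) Fₖ₊₁ (s<s (Finₚ.toℕ<n i)))

      bound : ∀ b {q′ g c} → just q ≡ just q′ → 0 < g → Cofactor F g c →
              2 ^ b * ((q′ ∸ 1) * φ g) ≡ 2 ^ a * φ F → 2 ^ b * (q′ * g) ≤ 2 ^ a * F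
      bound b {g = g} refl 0<g cof = extra-bound (2 ^ a) (2 ^ b) 0<g 2^a<q-1 (below-q {g} cof) cof

FermatNo-last : ∀ k (Fs : Fin (suc k) → ℕ) → (∀ i → FermatNo (suc (toℕ i)) (Fs i)) →
                FermatNo (suc k) (Fs (fromℕ k))
FermatNo-last k Fs Fs-fermat =
  subst (λ n → FermatNo (suc n) (Fs (fromℕ k))) (Finₚ.toℕ-fromℕ k) (Fs-fermat (fromℕ k))

fermatPrime∣prodFin-without-next : ∀ k (Fs : Fin k → ℕ) (Fs-fermat : ∀ i → FermatNo (suc (toℕ i)) (Fs i)) →
  (∀ q → ¬ FermatNo (suc k) q) → ∀ {p} → FermatPrime p → p ∣ prodFin k Fs
fermatPrime∣prodFin-without-next zero    Fs Fs-fermat none fp = ⊥-elim (none 3 FermatNo-1-3)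
fermatPrime∣prodFin-without-next (suc k) Fs Fs-fermat none {p} fp with p ≤? Fs (fromℕ k)
... | yes p≤Fₖ = let i , i≤1+k , dₚ = FermatNo-below (FermatNo-last k Fs Fs-fermat) fp p≤Fₖ
                 in FirstFermatPrimes.∣F (suc k) Fs Fs-fermat dₚ i≤1+k
... | no p≰Fₖ  = ⊥-elim (none _ (proj₂ (FermatNo-next (FermatNo-last k Fs Fs-fermat) fp (≰⇒> p≰Fₖ))))

proposition3p16 : (k : ℕ) (Fs : Fin k → ℕ) →
    (∀ i → FermatNo (suc (toℕ i)) (Fs i)) →
    ((q : ℕ) → FermatNo (suc k) q →
       (a : ℕ) → 1 ≤ a → 2 ^ a ≤ q ∸ 1 → InN₂ (2 ^ a * prodFin k Fs))
    × ((∀ q → ¬ FermatNo (suc k) q) →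
       (a : ℕ) → 1 ≤ a → InN₂ (2 ^ a * prodFin k Fs))
proposition3p16 k Fs Fs-fermat = with-next , without-next
  where
  open FirstFermatPrimes k Fs Fs-fermat

  with-next : (q : ℕ) → FermatNo (suc k) q → (a : ℕ) → 1 ≤ a → 2 ^ a ≤ q ∸ 1 → InN₂ (2 ^ a * F)
  with-next q Fₖ₊₁ (suc a) _ 2^[1+a]≤q-1 with FermatNo⇒FermatPrime Fₖ₊₁
  ... | _ , L , refl = InN₂-below-next {L} Fₖ₊₁ a 2^[1+a]≤q-1

  without-next : (∀ q → ¬ FermatNo (suc k) q) → (a : ℕ) → 1 ≤ a → InN₂ (2 ^ a * F)
  without-next none (suc a) _ =
    InN₂-2^[1+a]*F a nothing (inj₁ ∘ fermatPrime∣prodFin-without-next k Fs Fs-fermat none) λ _ ()
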